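{- Let $F_1$ and $F_2$ be finite fields with $|F_1|\le|F_2|$ and ${\rm char}(F_1)=2$. Then there exists a $(|F_1|-1)\times(|F_2|-1)$ Latin-sum array with $A=F_1\setminus\{0\}$, $B=F_2\setminus\{0\}$ over the alphabet $F_2\setminus\{0\}$.
   Context: Let $F_1,F_2$ be finite fields with $|F_1|\le|F_2|$, $A\subseteq F_1$, $B\subseteq F_2$ with $|A|\le|B|$. A table $L$ of size $|A|\times|B|$ with entries from a set $C$, rows indexed by elements of $A$ and columns by elements of $B$, is called an $|A|\times|B|$ Latin-sum array over $C$ if for every two distinct pairs $(x_1,y_1)\neq(x_2,y_2)$ in $A\times B$: (i) if $x_1+x_2=0$ in $F_1$ then $L_{x_1,y_1}\neq L_{x_2,y_2}$; and (ii) if $y_1+y_2=0$ in $F_2$ then $L_{x_1,y_1}\neq L_{x_2,y_2}$. -}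

module Defs where

open import Level using (0ℓ)
open import Data.Nat using (ℕ)
open import Data.Fin using (Fin)
open import Data.Product using (Σ; ∃; _×_; proj₁)
open import Relation.Nullary using (¬_)
open import Relation.Binary.PropositionalEquality using (_≡_; _≢_)
open import Function.Bundles using (_↔_)
open import Algebra.Core using (Op₁; Op₂)
open import Algebra.Structures using (IsCommutativeRing)

record FiniteField : Set₁ where
  field
    Carrier : Set
    _+_ _*_ : Op₂ Carrier
    -_      : Op₁ Carrier
    0# 1#   : Carrier
    isCommutativeRing : IsCommutativeRing _≡_ _+_ _*_ -_ 0# 1#
    0≢1     : 0# ≢ 1#
    inverse : ∀ x → x ≢ 0# → ∃ λ y → x * y ≡ 1#
    size    : ℕ
    enum    : Fin size ↔ Carrier

open FiniteField public using (Carrier; size)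

Char2 : FiniteField → Set
Char2 F = let open FiniteField F in (1# + 1#) ≡ 0#

NonZeroElt : FiniteField → Set
NonZeroElt F = Σ (Carrier F) λ x → x ≢ FiniteField.0# F

-- A Latin-sum array with rows indexed by A ⊆ F₁, columns by B ⊆ F₂
-- (subsets given as predicates), with entries in the alphabet C ⊆ T
-- (given as a predicate R on a type T); entries are compared as elements of T.
IsLatinSumArray : (F₁ F₂ : FiniteField)
  (A : Carrier F₁ → Set) (B : Carrier F₂ → Set)
  {T : Set} (R : T → Set)
  (L : Σ (Carrier F₁) A → Σ (Carrier F₂) B → Σ T R) → Set
IsLatinSumArray F₁ F₂ A B R L =
  ∀ (x₁ x₂ : Σ (Carrier F₁) A) (y₁ y₂ : Σ (Carrier F₂) B) →
    ¬ (proj₁ x₁ ≡ proj₁ x₂ × proj₁ y₁ ≡ proj₁ y₂) →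
      ((FiniteField._+_ F₁ (proj₁ x₁) (proj₁ x₂) ≡ FiniteField.0# F₁ →
          proj₁ (L x₁ y₁) ≢ proj₁ (L x₂ y₂))
     × (FiniteField._+_ F₂ (proj₁ y₁) (proj₁ y₂) ≡ FiniteField.0# F₂ →
          proj₁ (L x₁ y₁) ≢ proj₁ (L x₂ y₂)))

-- In characteristic 2 the condition x₁ + x₂ = 0 just says x₁ = x₂, so both
-- conditions (i) and (ii) reduce to "distinct cells in a common row (resp.
-- column) carry distinct entries". If F₂ also has characteristic 2, the array
-- L(x, y) = ι(x)·y is a Latin square in this sense as soon as ι : F₁* → F₂* is
-- injective, and such a ι exists because |F₁| ≤ |F₂|. If F₂ has odd
-- characteristic, y₁ + y₂ = 0 forces y₁ ≠ y₂, so L(x, y) = y already works.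
module Submission where

open import Defs
open import Data.Nat using (_≤_)
open import Data.Fin.Properties using (inject≤-injective; inj⇒≟)
open import Data.Product using (Σ; _,_)
open import Function.Bundles using (_↣_; mk↣; Injection)
open import Function.Construct.Composition using (_↣-∘_)
open import Function.Properties.Inverse using (↔⇒↣; ↔-sym)
open import Algebra.Structures using (IsCommutativeRing)
open import Relation.Nullary using (¬_; Dec; yes; no; contradiction)
open import Relation.Binary.Definitions using (DecidableEquality)
open import Relation.Binary.PropositionalEquality
  using (_≡_; _≢_; sym; trans; cong; module ≡-Reasoning)

module FieldProperties (F : FiniteField) where
  open FiniteField F
  open IsCommutativeRing isCommutativeRing
    using (*-identityʳ; *-assoc; *-comm; zeroˡ; zeroʳ; distribˡ; +-identityˡ; +-identityʳ; +-assoc)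
  open ≡-Reasoning

  _≟_ : DecidableEquality (Carrier F)
  _≟_ = inj⇒≟ (↔⇒↣ (↔-sym enum))

  char2? : Dec (Char2 F)
  char2? = (1# + 1#) ≟ 0#

  *-cancelʳ-≢0 : ∀ {c} → c ≢ 0# → ∀ a b → a * c ≡ b * c → a ≡ b
  *-cancelʳ-≢0 {c} c≢0 a b ac≡bc with inverse c c≢0
  ... | c⁻¹ , cc⁻¹≡1 = begin
    a              ≡⟨ sym (*-identityʳ a) ⟩
    a * 1#         ≡⟨ cong (a *_) (sym cc⁻¹≡1) ⟩
    a * (c * c⁻¹)  ≡⟨ sym (*-assoc a c c⁻¹) ⟩
    (a * c) * c⁻¹  ≡⟨ cong (_* c⁻¹) ac≡bc ⟩
    (b * c) * c⁻¹  ≡⟨ *-assoc b c c⁻¹ ⟩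
    b * (c * c⁻¹)  ≡⟨ cong (b *_) cc⁻¹≡1 ⟩
    b * 1#         ≡⟨ *-identityʳ b ⟩
    b              ∎

  *-cancelˡ-≢0 : ∀ {c} → c ≢ 0# → ∀ a b → c * a ≡ c * b → a ≡ b
  *-cancelˡ-≢0 {c} c≢0 a b ca≡cb =
    *-cancelʳ-≢0 c≢0 a b (trans (*-comm a c) (trans ca≡cb (*-comm c b)))

  *-≢0 : ∀ {a b} → a ≢ 0# → b ≢ 0# → a * b ≢ 0#
  *-≢0 {a} {b} a≢0 b≢0 ab≡0 = a≢0 (*-cancelʳ-≢0 b≢0 a 0# (trans ab≡0 (sym (zeroˡ b))))

  x*2≡x+x : ∀ x → x * (1# + 1#) ≡ x + x
  x*2≡x+x x = begin
    x * (1# + 1#)     ≡⟨ distribˡ x 1# 1# ⟩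
    (x * 1#) + (x * 1#) ≡⟨ cong (_+ (x * 1#)) (*-identityʳ x) ⟩
    x + (x * 1#)      ≡⟨ cong (x +_) (*-identityʳ x) ⟩
    x + x             ∎

  char2⇒x+y≡0⇒x≡y : Char2 F → ∀ x y → x + y ≡ 0# → x ≡ y
  char2⇒x+y≡0⇒x≡y char2 x y x+y≡0 = begin
    x              ≡⟨ sym (+-identityʳ x) ⟩
    x + 0#         ≡⟨ cong (x +_) (sym y+y≡0) ⟩
    x + (y + y)    ≡⟨ sym (+-assoc x y y) ⟩
    (x + y) + y    ≡⟨ cong (_+ y) x+y≡0 ⟩
    0# + y         ≡⟨ +-identityˡ y ⟩
    y              ∎
    where
    y+y≡0 : y + y ≡ 0#
    y+y≡0 = trans (sym (x*2≡x+x y)) (trans (cong (y *_) char2) (zeroʳ y))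

  ¬char2⇒x+x≢0 : ¬ Char2 F → ∀ {x} → x ≢ 0# → x + x ≢ 0#
  ¬char2⇒x+x≢0 ¬char2 {x} x≢0 x+x≡0 =
    x≢0 (*-cancelʳ-≢0 ¬char2 x 0# (trans (x*2≡x+x x) (trans x+x≡0 (sym (zeroˡ _)))))

-- If f happens to hit b, it does so at a single point, which is rerouted to
-- f a: that value is otherwise unused once a is removed from the domain.
module Puncture {A B : Set} (f : A ↣ B) (_≟_ : DecidableEquality B) (a : A) (b : B) where
  open Injection f using (to; injective)

  puncture : A → B
  puncture x with to x ≟ b
  ... | yes _ = to a
  ... | no _  = to x

  puncture-≢ : ∀ {x} → x ≢ a → puncture x ≢ b
  puncture-≢ {x} x≢a with to x ≟ b
  ... | yes fx≡b = λ fa≡b → x≢a (injective (trans fx≡b (sym fa≡b)))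
  ... | no fx≢b  = fx≢b

  puncture-injective : ∀ {x y} → x ≢ a → y ≢ a → puncture x ≡ puncture y → x ≡ y
  puncture-injective {x} {y} x≢a y≢a eq with to x ≟ b | to y ≟ b
  ... | yes fx≡b | yes fy≡b = injective (trans fx≡b (sym fy≡b))
  ... | yes _    | no _     = contradiction (injective (sym eq)) y≢a
  ... | no _     | yes _    = contradiction (injective eq) x≢a
  ... | no _     | no _     = injective eq

embedding : (F₁ F₂ : FiniteField) → size F₁ ≤ size F₂ → Carrier F₁ ↣ Carrier F₂
embedding F₁ F₂ size≤ =
  ↔⇒↣ (FiniteField.enum F₂)
    ↣-∘ (mk↣ (λ {i} {j} → inject≤-injective size≤ size≤ i j)
    ↣-∘ ↔⇒↣ (↔-sym (FiniteField.enum F₁)))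

module _ (F₁ F₂ : FiniteField) where
  private
    module F₁ = FiniteField F₁
    module F₂ = FiniteField F₂
    module P₁ = FieldProperties F₁
    module P₂ = FieldProperties F₂

  IsNonZeroLatinSumArray : (NonZeroElt F₁ → NonZeroElt F₂ → NonZeroElt F₂) → Set
  IsNonZeroLatinSumArray =
    IsLatinSumArray F₁ F₂ (_≢ F₁.0#) (_≢ F₂.0#) (_≢ F₂.0#)

  columnArray : NonZeroElt F₁ → NonZeroElt F₂ → NonZeroElt F₂
  columnArray _ y = y

  columnArray-isLatinSum : Char2 F₁ → ¬ Char2 F₂ → IsNonZeroLatinSumArray columnArray
  columnArray-isLatinSum char₁ ¬char₂ (x₁ , _) (x₂ , _) (y₁ , y₁≢0) (y₂ , _) distinct =
    (λ x₁+x₂≡0 y₁≡y₂ → distinct (P₁.char2⇒x+y≡0⇒x≡y char₁ x₁ x₂ x₁+x₂≡0 , y₁≡y₂))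
    , (λ y₁+y₂≡0 y₁≡y₂ →
         P₂.¬char2⇒x+x≢0 ¬char₂ y₁≢0 (trans (cong (y₁ F₂.+_) y₁≡y₂) y₁+y₂≡0))

  module _ (ι : Carrier F₁ → Carrier F₂) (ι-≢0 : ∀ {x} → x ≢ F₁.0# → ι x ≢ F₂.0#) where

    scaledArray : NonZeroElt F₁ → NonZeroElt F₂ → NonZeroElt F₂
    scaledArray (x , x≢0) (y , y≢0) = ι x F₂.* y , P₂.*-≢0 (ι-≢0 x≢0) y≢0

    scaledArray-isLatinSum :
      Char2 F₁ → Char2 F₂ →
      (∀ {x y} → x ≢ F₁.0# → y ≢ F₁.0# → ι x ≡ ι y → x ≡ y) →
      IsNonZeroLatinSumArray scaledArray
    scaledArray-isLatinSum char₁ char₂ ι-injective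
      (x₁ , x₁≢0) (x₂ , x₂≢0) (y₁ , y₁≢0) (y₂ , _) distinct =
      (λ x₁+x₂≡0 → let x₁≡x₂ = P₁.char2⇒x+y≡0⇒x≡y char₁ x₁ x₂ x₁+x₂≡0 in
         λ eq → distinct (x₁≡x₂ , P₂.*-cancelˡ-≢0 (ι-≢0 x₁≢0) y₁ y₂
           (trans eq (cong (λ x → ι x F₂.* y₂) (sym x₁≡x₂)))))
      , (λ y₁+y₂≡0 → let y₁≡y₂ = P₂.char2⇒x+y≡0⇒x≡y char₂ y₁ y₂ y₁+y₂≡0 in
         λ eq → distinct (ι-injective x₁≢0 x₂≢0 (P₂.*-cancelʳ-≢0 y₁≢0 (ι x₁) (ι x₂)
           (trans eq (cong (ι x₂ F₂.*_) (sym y₁≡y₂)))) , y₁≡y₂))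

mainTheorem9 : (F₁ F₂ : FiniteField) → size F₁ ≤ size F₂ → Char2 F₁ →
    Σ (NonZeroElt F₁ → NonZeroElt F₂ → NonZeroElt F₂) λ L →
      IsLatinSumArray F₁ F₂ (λ x → x ≢ FiniteField.0# F₁) (λ y → y ≢ FiniteField.0# F₂)
        (λ z → z ≢ FiniteField.0# F₂) L
mainTheorem9 F₁ F₂ size≤ char₁ with FieldProperties.char2? F₂
... | no ¬char₂ = columnArray F₁ F₂ , columnArray-isLatinSum F₁ F₂ char₁ ¬char₂
... | yes char₂ =
  scaledArray F₁ F₂ puncture puncture-≢
  , scaledArray-isLatinSum F₁ F₂ puncture puncture-≢ char₁ char₂ puncture-injective
  where
  open Puncture (embedding F₁ F₂ size≤) (FieldProperties._≟_ F₂)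
    (FiniteField.0# F₁) (FiniteField.0# F₂)
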